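{- The number of minimal colorings, up to isomorphism, of the nonzero rational numbers for the equation $x_1+x_2+x_3=4x_4$ is $2^{\aleph_0}$.
   Context: A coloring of the nonzero rationals is minimal for a linear homogeneous equation if it has no monochromatic solution (a solution in nonzero rationals, variables not necessarily distinct, all of the same color) and uses as few colors as possible among all such colorings. Two colorings $c_1\colon S\to C_1$, $c_2\colon S\to C_2$ of the same set are isomorphic if there is a bijection $\phi\colon C_2\to C_1$ with $c_1=\phi\circ c_2$. -}

module Defs where

open import Data.Nat using (ℕ; _<_)
open import Data.Fin using (Fin)
open import Data.Bool using (Bool)
open import Data.Rational using (ℚ; NonZero; _+_; _*_; _/_)
open import Data.Integer using (+_)
open import Data.Product using (Σ; _×_; proj₁)
open import Function.Bundles using (_⤖_; Bijection)
open import Relation.Binary.PropositionalEquality using (_≡_; _≗_)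
open import Relation.Nullary using (¬_)
open import Axiom.ExcludedMiddle using (ExcludedMiddle)
open import Level using (0ℓ)

-- The nonzero rationals (NonZero is a proof-irrelevant record predicate).
ℚ* : Set
ℚ* = Σ ℚ NonZero

val : ℚ* → ℚ
val = proj₁

four : ℚ
four = + 4 / 1

IsSolution : ℚ* → ℚ* → ℚ* → ℚ* → Set
IsSolution x₁ x₂ x₃ x₄ = (val x₁ + val x₂) + val x₃ ≡ four * val x₄

-- A coloring of ℚ* with a color set C.
-- A monochromatic solution: a solution whose four entries (not
-- necessarily distinct) all receive the same color.
MonochromaticSolution : {C : Set} → (ℚ* → C) → Set
MonochromaticSolution {C} c =
  Σ ℚ* λ x₁ → Σ ℚ* λ x₂ → Σ ℚ* λ x₃ → Σ ℚ* λ x₄ →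
    IsSolution x₁ x₂ x₃ x₄ ×
    (c x₁ ≡ c x₄) × (c x₂ ≡ c x₄) × (c x₃ ≡ c x₄)

SolutionFree : {C : Set} → (ℚ* → C) → Set
SolutionFree c = ¬ MonochromaticSolution c

record MinimalColoring : Set where
  field
    m        : ℕ
    col      : ℚ* → Fin m
    free     : SolutionFree col
    minimal  : ∀ k → k < m → (d : ℚ* → Fin k) → ¬ SolutionFree d

open MinimalColoring public

Isomorphic : MinimalColoring → MinimalColoring → Set
Isomorphic c₁ c₂ =
  Σ (Fin (m c₂) ⤖ Fin (m c₁)) λ φ →
    ∀ x → col c₁ x ≡ Bijection.to φ (col c₂ x)

-- There are at least 2^ℵ₀ isomorphism classes: an injection from
-- (ℕ → Bool) into the classes.
AtLeastContinuum : Set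
AtLeastContinuum =
  Σ ((ℕ → Bool) → MinimalColoring) λ g →
    ∀ a b → Isomorphic (g a) (g b) → a ≗ b

-- There are at most 2^ℵ₀ isomorphism classes: a map of the classes
-- into (ℕ → Bool) (well defined on classes and injective on classes).
AtMostContinuum : Set
AtMostContinuum =
  Σ (MinimalColoring → (ℕ → Bool)) λ f →
    (∀ c d → Isomorphic c d → f c ≗ f d) ×
    (∀ c d → f c ≗ f d → Isomorphic c d)

module Submission where

open import Data.Nat as ℕ using (ℕ; zero; suc; z≤n; s≤s; _∸_)
import Data.Nat.Properties as ℕP
import Data.Nat.Divisibility as ℕD
open import Data.Nat.Primality using (Prime; prime?; euclidsLemma)
open import Data.Nat.Coprimality as Coprimality using (1-coprimeTo)
open import Data.Fin using (Fin; fromℕ<; inject≤; punchOut)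
open import Data.Fin.Patterns using (0F; 1F; 2F; 3F)
open import Data.Fin.Properties using (fromℕ<-injective; inject≤-injective; punchOut-injective)
open import Data.Integer as ℤ using (ℤ; +_; -[1+_]; 0ℤ; 1ℤ; _+_; _*_; _-_; -_; _^_; _%ℕ_; _/ℕ_)
import Data.Integer.Properties as ℤP
open import Data.Integer.DivMod using (a≡a%ℕn+[a/ℕn]*n; n%ℕd<d)
open import Data.Integer.Divisibility.Signed
  using (_∣_; divides; ∣-refl; ∣ᵤ⇒∣; ∣⇒∣ᵤ; ∣m⇒∣m*n; ∣n⇒∣m*n; ∣m⇒∣-m; ∣m∣n⇒∣m+n; ∣m∣n⇒∣m-n)
open import Data.Integer.Tactic.RingSolver using (solve-∀)
open import Data.Rational as ℚ using (mkℚ; ↥_; ↧_; ↧ₙ_; toℚᵘ)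
open import Data.Rational.Properties using (toℚᵘ-homo-+; toℚᵘ-homo-*; toℚᵘ-cong)
import Data.Rational.Unnormalised as ℚᵘ
import Data.Rational.Unnormalised.Properties as ℚᵘP
open import Data.List using (allFin)
import Data.List.Relation.Unary.All as All
open import Data.List.Membership.Propositional.Properties using (∈-allFin)
open import Data.List.Extrema ℕP.≤-totalOrder using (argmin; f[argmin]≤f[xs])
open import Data.Bool using (Bool; true; false)
open import Data.Product as Product using (Σ; Σ-syntax; ∃; _×_; _,_; proj₁; proj₂)
open import Data.Sum using (_⊎_; inj₁; inj₂; [_,_]′)
open import Function using (_∘_; id)
open import Function.Bundles using (Bijection; Equivalence; _⇔_; mk⤖; mk⇔)
open import Function.Consequences.Propositional using (strictlySurjective⇒surjective)
open import Function.Definitions using (Injective)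
open import Relation.Nullary using (¬_; yes; no; does; contradiction)
open import Relation.Nullary.Decidable
  using (False; from-yes; toWitnessFalse; dec-true; dec-false; does-⇔; decidable-stable)
open import Relation.Binary.PropositionalEquality
open import Axiom.ExcludedMiddle using (ExcludedMiddle)
open import Level using (0ℓ)
open import Defs

-- Write a nonzero rational as x = 5^ℓ · u with u a 5-adic unit, and let ρ x be the class of u
-- in (ℤ/5)ˣ. A colouring in which two points of the same colour and the same level ℓ always have
-- the same ρ is solution-free: after clearing denominators in x₁ + x₂ + x₃ = 4x₄ and dividing by
-- the least power of 5 present, what is left modulo 5 is the common residue of the terms of
-- minimal level times a non-empty subsum of 1, 1, 1, -4, and no such subsum is divisible by 5.
-- Colouring each level by ρ uses four colours, and the colours may be permuted level by level:
-- swapping two of them on level n + 1 according to the n-th bit of a sequence makes the sequence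
-- readable from the colours of 1 and 5ⁿ⁺¹, so continuum many of these colourings are pairwise
-- non-isomorphic. Three colours never suffice (a finite search over 1, …, 12), so all of them are
-- minimal. Conversely, under excluded middle a minimal colouring uses every colour, hence is
-- determined up to isomorphism by which pairs of points share a colour, and the pairs of ℚ* are
-- coded by natural numbers.

-- The 5-adic valuation of an integer

5ℤ : ℤ
5ℤ = + 5

pos-^ : ∀ m k → + (m ℕ.^ k) ≡ (+ m) ^ k
pos-^ m zero    = refl
pos-^ m (suc k) = trans (ℤP.pos-* m (m ℕ.^ k)) (cong (+ m *_) (pos-^ m k))

5^≢0 : ∀ k → 5ℤ ^ k ≢ 0ℤ
5^≢0 k 5^k≡0 with ℤP.i^n≡0⇒i≡0 5ℤ k 5^k≡0
... | ()

5∣5^suc : ∀ k w → 5ℤ ∣ 5ℤ ^ suc k * w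
5∣5^suc k w = ∣m⇒∣m*n w (∣m⇒∣m*n (5ℤ ^ k) ∣-refl)

5-prime : Prime 5
5-prime = from-yes (prime? 5)

5∣*⇒5∣⊎5∣ : ∀ u w → 5ℤ ∣ u * w → 5ℤ ∣ u ⊎ 5ℤ ∣ w
5∣*⇒5∣⊎5∣ u w 5∣uw
  with euclidsLemma ℤ.∣ u ∣ ℤ.∣ w ∣ 5-prime (subst (5 ℕD.∣_) (ℤP.abs-* u w) (∣⇒∣ᵤ 5∣uw))
... | inj₁ 5∣u = inj₁ (∣ᵤ⇒∣ 5∣u)
... | inj₂ 5∣w = inj₂ (∣ᵤ⇒∣ 5∣w)

5∤-* : ∀ {u w} → ¬ 5ℤ ∣ u → ¬ 5ℤ ∣ w → ¬ 5ℤ ∣ u * w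
5∤-* {u} {w} 5∤u 5∤w 5∣uw = [ 5∤u , 5∤w ]′ (5∣*⇒5∣⊎5∣ u w 5∣uw)

5∤-by-computation : ∀ a {5∤a : False (5 ℕD.∣? ℤ.∣ a ∣)} → ¬ 5ℤ ∣ a
5∤-by-computation a {5∤a} 5∣a = toWitnessFalse 5∤a (∣⇒∣ᵤ 5∣a)

factor₅ : (fuel n : ℕ) → ℕ × ℕ
factor₅ zero    n = 0 , n
factor₅ (suc k) n with 5 ℕD.∣? n
... | yes (ℕD.divides q _) = Product.map₁ suc (factor₅ k q)
... | no _                 = 0 , n

factor₅-correct : ∀ k n → n ≡ 5 ℕ.^ proj₁ (factor₅ k n) ℕ.* proj₂ (factor₅ k n)
factor₅-correct zero    n = sym (ℕP.*-identityˡ n)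
factor₅-correct (suc k) n with 5 ℕD.∣? n
... | no _ = sym (ℕP.*-identityˡ n)
... | yes (ℕD.divides q n≡q*5) = begin
  n                       ≡⟨ n≡q*5 ⟩
  q ℕ.* 5                 ≡⟨ ℕP.*-comm q 5 ⟩
  5 ℕ.* q                 ≡⟨ cong (5 ℕ.*_) (factor₅-correct k q) ⟩
  5 ℕ.* (5 ℕ.^ a ℕ.* u)   ≡⟨ ℕP.*-assoc 5 (5 ℕ.^ a) u ⟨
  5 ℕ.^ suc a ℕ.* u       ∎
  where
  open ≡-Reasoning
  a u : ℕ
  a = proj₁ (factor₅ k q)
  u = proj₂ (factor₅ k q)

factor₅-5∤ : ∀ k n → 0 ℕ.< n → n ℕ.≤ k → ¬ 5 ℕD.∣ proj₂ (factor₅ k n)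
factor₅-5∤ zero    n 0<n n≤0 = contradiction (ℕP.<-≤-trans 0<n n≤0) (λ ())
factor₅-5∤ (suc k) n 0<n n≤k with 5 ℕD.∣? n
... | no 5∤n = 5∤n
... | yes (ℕD.divides zero refl) = contradiction 0<n (λ ())
... | yes (ℕD.divides q@(suc _) n≡q*5) =
  factor₅-5∤ k q ℕ.z<s (ℕP.≤-pred (ℕP.<-≤-trans q<n n≤k))
  where
  q<n : q ℕ.< n
  q<n = subst (q ℕ.<_) (sym n≡q*5) (ℕP.m<m*n q 5 (s≤s (s≤s z≤n)))

ν : ℤ → ℕ
ν i = proj₁ (factor₅ ℤ.∣ i ∣ ℤ.∣ i ∣)

unit : ℤ → ℤ
unit (+ n)    = + proj₂ (factor₅ n n)
unit -[1+ n ] = - + proj₂ (factor₅ (suc n) (suc n))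

ν-unit-correct : ∀ i → i ≡ 5ℤ ^ ν i * unit i
ν-unit-correct (+ n) = begin
  + n                 ≡⟨ cong +_ (factor₅-correct n n) ⟩
  + (5 ℕ.^ a ℕ.* u)   ≡⟨ ℤP.pos-* (5 ℕ.^ a) u ⟩
  + (5 ℕ.^ a) * + u   ≡⟨ cong (_* + u) (pos-^ 5 a) ⟩
  5ℤ ^ a * + u        ∎
  where
  open ≡-Reasoning
  a u : ℕ
  a = proj₁ (factor₅ n n)
  u = proj₂ (factor₅ n n)
ν-unit-correct -[1+ n ] = begin
  - + suc n          ≡⟨ cong -_ (ν-unit-correct (+ suc n)) ⟩
  - (5ℤ ^ a * + u)   ≡⟨ ℤP.neg-distribʳ-* (5ℤ ^ a) (+ u) ⟩
  5ℤ ^ a * - + u     ∎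
  where
  open ≡-Reasoning
  a u : ℕ
  a = proj₁ (factor₅ (suc n) (suc n))
  u = proj₂ (factor₅ (suc n) (suc n))

5∤unit : ∀ {i} → i ≢ 0ℤ → ¬ 5ℤ ∣ unit i
5∤unit {+ zero}    i≢0 = contradiction refl i≢0
5∤unit {+ suc n}   _   = factor₅-5∤ (suc n) (suc n) ℕ.z<s ℕP.≤-refl ∘ ∣⇒∣ᵤ
5∤unit { -[1+ n ]} _   =
  5∤unit {+ suc n} (λ ()) ∘ subst (5ℤ ∣_) (ℤP.neg-involutive _) ∘ ∣m⇒∣-m

5-adic-unique : ∀ a b {u w} → ¬ 5ℤ ∣ u → ¬ 5ℤ ∣ w →
                5ℤ ^ a * u ≡ 5ℤ ^ b * w → a ≡ b × u ≡ w
5-adic-unique zero zero {u} {w} _ _ eq =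
  refl , trans (sym (ℤP.*-identityˡ u)) (trans eq (ℤP.*-identityˡ w))
5-adic-unique zero (suc b) {u} {w} 5∤u _ eq =
  contradiction (subst (5ℤ ∣_) (trans (sym eq) (ℤP.*-identityˡ u)) (5∣5^suc b w)) 5∤u
5-adic-unique (suc a) zero {u} {w} _ 5∤w eq =
  contradiction (subst (5ℤ ∣_) (trans eq (ℤP.*-identityˡ w)) (5∣5^suc a u)) 5∤w
5-adic-unique (suc a) (suc b) {u} {w} 5∤u 5∤w eq =
  Product.map₁ (cong suc) (5-adic-unique a b 5∤u 5∤w (ℤP.*-cancelˡ-≡ 5ℤ _ _ 5[5^a*u]≡5[5^b*w]))
  where
  5[5^a*u]≡5[5^b*w] : 5ℤ * (5ℤ ^ a * u) ≡ 5ℤ * (5ℤ ^ b * w)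
  5[5^a*u]≡5[5^b*w] = trans (sym (ℤP.*-assoc 5ℤ (5ℤ ^ a) u)) (trans eq (ℤP.*-assoc 5ℤ (5ℤ ^ b) w))

*-decomposition : ∀ i j → i * j ≡ 5ℤ ^ (ν i ℕ.+ ν j) * (unit i * unit j)
*-decomposition i j = begin
  i * j                                      ≡⟨ cong₂ _*_ (ν-unit-correct i) (ν-unit-correct j) ⟩
  (5ℤ ^ ν i * unit i) * (5ℤ ^ ν j * unit j)  ≡⟨ interchange (5ℤ ^ ν i) (unit i) (5ℤ ^ ν j) (unit j) ⟩
  (5ℤ ^ ν i * 5ℤ ^ ν j) * (unit i * unit j)  ≡⟨ cong (_* (unit i * unit j)) (ℤP.^-distribˡ-+-* 5ℤ (ν i) (ν j)) ⟨
  5ℤ ^ (ν i ℕ.+ ν j) * (unit i * unit j)     ∎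
  where
  open ≡-Reasoning
  interchange : ∀ p u q w → (p * u) * (q * w) ≡ (p * q) * (u * w)
  interchange = solve-∀

ν-unit-cross : ∀ {a b c e} → a ≢ 0ℤ → b ≢ 0ℤ → c ≢ 0ℤ → e ≢ 0ℤ → a * b ≡ c * e →
               ν a ℕ.+ ν b ≡ ν c ℕ.+ ν e × unit a * unit b ≡ unit c * unit e
ν-unit-cross {a} {b} {c} {e} a≢0 b≢0 c≢0 e≢0 ab≡ce =
  5-adic-unique _ _ (5∤-* (5∤unit a≢0) (5∤unit b≢0)) (5∤-* (5∤unit c≢0) (5∤unit e≢0))
    (trans (sym (*-decomposition a b)) (trans ab≡ce (*-decomposition c e)))

residue₅ : ℤ → ℕ
residue₅ i = i %ℕ 5

residue₅<5 : ∀ i → residue₅ i ℕ.< 5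
residue₅<5 i = n%ℕd<d i 5

5∣i-residue₅ : ∀ i → 5ℤ ∣ i - + residue₅ i
5∣i-residue₅ i = divides (i /ℕ 5) (begin
  i - r                   ≡⟨ cong (_- r) (a≡a%ℕn+[a/ℕn]*n i 5) ⟩
  (r + i /ℕ 5 * 5ℤ) - r   ≡⟨ cancel r (i /ℕ 5 * 5ℤ) ⟩
  i /ℕ 5 * 5ℤ             ∎)
  where
  open ≡-Reasoning
  r : ℤ
  r = + residue₅ i
  cancel : ∀ r x → (r + x) - r ≡ x
  cancel = solve-∀

residue₅-≡⇒5∣- : ∀ i j → residue₅ i ≡ residue₅ j → 5ℤ ∣ i - j
residue₅-≡⇒5∣- i j rᵢ≡rⱼ = subst (5ℤ ∣_) (cancel i j (+ residue₅ i)) (∣m∣n⇒∣m-n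
  (5∣i-residue₅ i) (subst (λ r → 5ℤ ∣ j - + r) (sym rᵢ≡rⱼ) (5∣i-residue₅ j)))
  where
  cancel : ∀ i j r → (i - r) - (j - r) ≡ i - j
  cancel = solve-∀

residue₅≡0⇒5∣ : ∀ i → residue₅ i ≡ 0 → 5ℤ ∣ i
residue₅≡0⇒5∣ i r≡0 =
  subst (5ℤ ∣_) (ℤP.+-identityʳ i) (subst (λ r → 5ℤ ∣ i - + r) r≡0 (5∣i-residue₅ i))

fermat₅ : ∀ t → ¬ 5ℤ ∣ t → 5ℤ ∣ t * t * t * t - 1ℤ
fermat₅ t 5∤t = subst (5ℤ ∣_) (sym (split t (+ residue₅ t)))
  (∣m∣n⇒∣m+n (small (residue₅ t) (residue₅<5 t) (5∤t ∘ residue₅≡0⇒5∣ t))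
              (∣m⇒∣m*n _ (5∣i-residue₅ t)))
  where
  split : ∀ x y → x * x * x * x - 1ℤ ≡
          (y * y * y * y - 1ℤ) + (x - y) * (x * x * x + x * x * y + x * y * y + y * y * y)
  split = solve-∀
  small : ∀ r → r ℕ.< 5 → r ≢ 0 → 5ℤ ∣ + r * + r * + r * + r - 1ℤ
  small 0 _ 0≢0 = contradiction refl 0≢0
  small 1 _ _   = divides (+ 0) refl
  small 2 _ _   = divides (+ 3) refl
  small 3 _ _   = divides (+ 16) refl
  small 4 _ _   = divides (+ 51) refl
  small (suc (suc (suc (suc (suc _))))) (s≤s (s≤s (s≤s (s≤s (s≤s ()))))) _

-- Modulo m, U ≡ U w⁴ = u w³ W and likewise U' ≡ u' w'³ W.
congruent-units : ∀ {m} U U' u u' w w' W → U * w ≡ u * W → U' * w' ≡ u' * W →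
                  m ∣ w * w * w * w - 1ℤ → m ∣ w' * w' * w' * w' - 1ℤ →
                  m ∣ u * (w * w * w) - u' * (w' * w' * w') → m ∣ U - U'
congruent-units {m} U U' u u' w w' W Uw≡uW U'w'≡u'W m∣w⁴-1 m∣w'⁴-1 m∣uw³-u'w'³ =
  subst (m ∣_) (sym (identity U U' u u' w w' W))
    (∣m∣n⇒∣m-n (∣m∣n⇒∣m+n (∣m∣n⇒∣m+n (∣m∣n⇒∣m-n (∣m⇒∣m*n W m∣uw³-u'w'³)
                                                (∣n⇒∣m*n U m∣w⁴-1))
                                    (∣n⇒∣m*n U' m∣w'⁴-1))
                         (∣m⇒∣m*n (w * w * w) (∣0 (ℤP.i≡j⇒i-j≡0 Uw≡uW))))
               (∣m⇒∣m*n (w' * w' * w') (∣0 (ℤP.i≡j⇒i-j≡0 U'w'≡u'W))))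
  where
  ∣0 : ∀ {a} → a ≡ 0ℤ → m ∣ a
  ∣0 refl = divides 0ℤ refl
  identity : ∀ U U' u u' w w' W → U - U' ≡
    (u * (w * w * w) - u' * (w' * w' * w')) * W
      - U * (w * w * w * w - 1ℤ) + U' * (w' * w' * w' * w' - 1ℤ)
      + (U * w - u * W) * (w * w * w) - (U' * w' - u' * W) * (w' * w' * w')
  identity = solve-∀

Λ : (Fin 4 → ℤ) → ℤ
Λ x = x 0F + x 1F + x 2F - + 4 * x 3F

Λ-cong : ∀ {x y} → (∀ i → x i ≡ y i) → Λ x ≡ Λ y
Λ-cong x≗y = cong₂ _-_ (cong₂ _+_ (cong₂ _+_ (x≗y 0F) (x≗y 1F)) (x≗y 2F)) (cong (+ 4 *_) (x≗y 3F))

Λ-scale : ∀ c x → Λ (λ i → c * x i) ≡ c * Λ x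
Λ-scale c x = linear c (x 0F) (x 1F) (x 2F) (x 3F)
  where
  linear : ∀ c a b d e → c * a + c * b + c * d - + 4 * (c * e) ≡ c * (a + b + d - + 4 * e)
  linear = solve-∀

Λ-sub-scale : ∀ x y t → Λ (λ i → x i - y i * t) ≡ Λ x - Λ y * t
Λ-sub-scale x y t = linear (x 0F) (x 1F) (x 2F) (x 3F) (y 0F) (y 1F) (y 2F) (y 3F) t
  where
  linear : ∀ a b c d a' b' c' d' t →
    (a - a' * t) + (b - b' * t) + (c - c' * t) - + 4 * (d - d' * t) ≡
    (a + b + c - + 4 * d) - (a' + b' + c' - + 4 * d') * t
  linear = solve-∀

Λ-∣ : ∀ {m} x → (∀ i → m ∣ x i) → m ∣ Λ x
Λ-∣ x m∣x = ∣m∣n⇒∣m-n (∣m∣n⇒∣m+n (∣m∣n⇒∣m+n (m∣x 0F) (m∣x 1F)) (m∣x 2F)) (∣n⇒∣m*n (+ 4) (m∣x 3F))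

Λ≡0-cancel : ∀ c z → c ≢ 0ℤ → Λ (λ i → c * z i) ≡ 0ℤ → Λ z ≡ 0ℤ
Λ≡0-cancel c z c≢0 Λcz≡0 =
  [ (λ c≡0 → contradiction c≡0 c≢0) , id ]′ (ℤP.i*j≡0⇒i≡0∨j≡0 c (trans (sym (Λ-scale c z)) Λcz≡0))

Λ≡0⇒∣Λ* : ∀ {m} z y t → Λ z ≡ 0ℤ → (∀ i → m ∣ z i - y i * t) → m ∣ Λ y * t
Λ≡0⇒∣Λ* {m} z y t Λz≡0 m∣z-yt = subst (m ∣_) (begin
  - (Λ z - Λ y * t)   ≡⟨ cong (λ a → - (a - Λ y * t)) Λz≡0 ⟩
  - (0ℤ - Λ y * t)    ≡⟨ negate (Λ y * t) ⟩
  Λ y * t             ∎)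
  (∣m⇒∣-m (subst (m ∣_) (Λ-sub-scale z y t) (Λ-∣ (λ i → z i - y i * t) m∣z-yt)))
  where
  open ≡-Reasoning
  negate : ∀ a → - (0ℤ - a) ≡ a
  negate = solve-∀

ε : ℕ → ℤ
ε zero    = 1ℤ
ε (suc _) = 0ℤ

-- No non-empty subfamily of the coefficients 1, 1, 1, -4 sums to a multiple of 5.
5∤Λ-ε : ∀ (k : Fin 4 → ℕ) i → k i ≡ 0 → ¬ 5ℤ ∣ Λ (ε ∘ k)
5∤Λ-ε k i kᵢ≡0 with k 0F in k₀ | k 1F in k₁ | k 2F in k₂ | k 3F in k₃
... | zero  | zero  | zero  | zero  = 5∤-by-computation _
... | zero  | zero  | zero  | suc _ = 5∤-by-computation _
... | zero  | zero  | suc _ | zero  = 5∤-by-computation _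
... | zero  | zero  | suc _ | suc _ = 5∤-by-computation _
... | zero  | suc _ | zero  | zero  = 5∤-by-computation _
... | zero  | suc _ | zero  | suc _ = 5∤-by-computation _
... | zero  | suc _ | suc _ | zero  = 5∤-by-computation _
... | zero  | suc _ | suc _ | suc _ = 5∤-by-computation _
... | suc _ | zero  | zero  | zero  = 5∤-by-computation _
... | suc _ | zero  | zero  | suc _ = 5∤-by-computation _
... | suc _ | zero  | suc _ | zero  = 5∤-by-computation _
... | suc _ | zero  | suc _ | suc _ = 5∤-by-computation _
... | suc _ | suc _ | zero  | zero  = 5∤-by-computation _
... | suc _ | suc _ | zero  | suc _ = 5∤-by-computation _
... | suc _ | suc _ | suc _ | zero  = 5∤-by-computation _
... | suc _ | suc _ | suc _ | suc _ = contradiction kᵢ≡0 (k≢0 i)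
  where
  k≢0 : ∀ j → k j ≢ 0
  k≢0 0F kⱼ≡0 with () ← trans (sym k₀) kⱼ≡0
  k≢0 1F kⱼ≡0 with () ← trans (sym k₁) kⱼ≡0
  k≢0 2F kⱼ≡0 with () ← trans (sym k₂) kⱼ≡0
  k≢0 3F kⱼ≡0 with () ← trans (sym k₃) kⱼ≡0

-- Divide by 5^μ, μ the least valuation: modulo 5 the entries of valuation μ all become the unit
-- t of the entry m i₀ and the others vanish, so 5 would divide t times a non-empty subsum of the
-- coefficients.
Λ≢0-of-congruent-units : ∀ (m : Fin 4 → ℤ) → (∀ i → m i ≢ 0ℤ) →
  (∀ i j → ν (m i) ≡ ν (m j) → 5ℤ ∣ unit (m i) - unit (m j)) → Λ m ≢ 0ℤ
Λ≢0-of-congruent-units m m≢0 congruent Λm≡0 =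
  [ 5∤Λ-ε k i₀ (ℕP.n∸n≡0 μ) , 5∤unit (m≢0 i₀) ]′
    (5∣*⇒5∣⊎5∣ (Λ (ε ∘ k)) t (Λ≡0⇒∣Λ* z (ε ∘ k) t Λz≡0 z≡εt))
  where
  i₀ : Fin 4
  i₀ = argmin (ν ∘ m) 0F (allFin 4)
  μ : ℕ
  μ = ν (m i₀)
  μ≤ν : ∀ i → μ ℕ.≤ ν (m i)
  μ≤ν i = All.lookup (f[argmin]≤f[xs] {f = ν ∘ m} 0F (allFin 4)) (∈-allFin i)
  k : Fin 4 → ℕ
  k i = ν (m i) ∸ μ
  z : Fin 4 → ℤ
  z i = 5ℤ ^ k i * unit (m i)
  t : ℤ
  t = unit (m i₀)
  m≡5^μ*z : ∀ i → m i ≡ 5ℤ ^ μ * z i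
  m≡5^μ*z i = begin
    m i                              ≡⟨ ν-unit-correct (m i) ⟩
    5ℤ ^ ν (m i) * unit (m i)        ≡⟨ cong (λ n → 5ℤ ^ n * unit (m i)) (ℕP.m+[n∸m]≡n (μ≤ν i)) ⟨
    5ℤ ^ (μ ℕ.+ k i) * unit (m i)    ≡⟨ cong (_* unit (m i)) (ℤP.^-distribˡ-+-* 5ℤ μ (k i)) ⟩
    5ℤ ^ μ * 5ℤ ^ k i * unit (m i)   ≡⟨ ℤP.*-assoc (5ℤ ^ μ) (5ℤ ^ k i) (unit (m i)) ⟩
    5ℤ ^ μ * z i                     ∎
    where open ≡-Reasoning
  Λz≡0 : Λ z ≡ 0ℤ
  Λz≡0 = Λ≡0-cancel (5ℤ ^ μ) z (5^≢0 μ) (trans (sym (Λ-cong {m} {λ i → 5ℤ ^ μ * z i} m≡5^μ*z)) Λm≡0)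
  z≡εt : ∀ i → 5ℤ ∣ z i - ε (k i) * t
  z≡εt i = term (k i) refl
    where
    term : ∀ n → k i ≡ n → 5ℤ ∣ 5ℤ ^ n * unit (m i) - ε n * t
    term (suc n) _    =
      subst (5ℤ ∣_) (sym (ℤP.+-identityʳ (5ℤ ^ suc n * unit (m i)))) (5∣5^suc n (unit (m i)))
    term zero    kᵢ≡0 =
      subst (5ℤ ∣_) (sym (cong₂ _-_ (ℤP.*-identityˡ (unit (m i))) (ℤP.*-identityˡ t)))
        (congruent i i₀ (ℕP.≤-antisym (ℕP.m∸n≡0⇒m≤n kᵢ≡0) (μ≤ν i)))

-- Separated colourings are solution-free

a+b≡c+e⇒c-b≡a-e : ∀ {a b c e} → a + b ≡ c + e → c - b ≡ a - e
a+b≡c+e⇒c-b≡a-e {a} {b} {c} {e} a+b≡c+e = begin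
  c - b               ≡⟨ add-both c b e ⟩
  (c + e) - (b + e)   ≡⟨ cong (_- (b + e)) a+b≡c+e ⟨
  (a + b) - (b + e)   ≡⟨ cancel a b e ⟩
  a - e               ∎
  where
  open ≡-Reasoning
  add-both : ∀ c b e → c - b ≡ (c + e) - (b + e)
  add-both = solve-∀
  cancel : ∀ a b e → (a + b) - (b + e) ≡ a - e
  cancel = solve-∀

*-≢0 : ∀ {a b} → a ≢ 0ℤ → b ≢ 0ℤ → a * b ≢ 0ℤ
*-≢0 {a} a≢0 b≢0 ab≡0 = [ a≢0 , b≢0 ]′ (ℤP.i*j≡0⇒i≡0∨j≡0 a ab≡0)

solution-≃ᵘ : ∀ p q r s → (p ℚ.+ q) ℚ.+ r ≡ four ℚ.* s →
              (toℚᵘ p ℚᵘ.+ toℚᵘ q) ℚᵘ.+ toℚᵘ r ℚᵘ.≃ ℚᵘ.mkℚᵘ (+ 4) 0 ℚᵘ.* toℚᵘ s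
solution-≃ᵘ p q r s eq = ℚᵘP.≃-trans
  (ℚᵘP.≃-sym (ℚᵘP.≃-trans (toℚᵘ-homo-+ (p ℚ.+ q) r) (ℚᵘP.+-congˡ (toℚᵘ r) (toℚᵘ-homo-+ p q))))
  (ℚᵘP.≃-trans (toℚᵘ-cong eq) (toℚᵘ-homo-* four s))

cross-multiplied : ∀ p q r s → (p ℚ.+ q) ℚ.+ r ≡ four ℚ.* s →
  ↥ p * (↧ q * ↧ r * ↧ s) + ↥ q * (↧ p * ↧ r * ↧ s) + ↥ r * (↧ p * ↧ q * ↧ s)
    - + 4 * (↥ s * (↧ p * ↧ q * ↧ r)) ≡ 0ℤ
cross-multiplied p@record{} q@record{} r@record{} s@record{} eq = begin
  ↥ p * (↧ q * ↧ r * ↧ s) + ↥ q * (↧ p * ↧ r * ↧ s) + ↥ r * (↧ p * ↧ q * ↧ s)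
    - + 4 * (↥ s * (↧ p * ↧ q * ↧ r))
    ≡⟨ expand (↥ p) (↥ q) (↥ r) (↥ s) (↧ p) (↧ q) (↧ r) (↧ s) ⟩
  ((↥ p * ↧ q + ↥ q * ↧ p) * ↧ r + ↥ r * (↧ p * ↧ q)) * (+ 1 * ↧ s)
    - (+ 4 * ↥ s) * (↧ p * ↧ q * ↧ r)
    ≡⟨ cong₂ _-_ (cong₂ (λ a b → ((↥ p * ↧ q + ↥ q * ↧ p) * ↧ r + ↥ r * a) * b)
                        (sym (ℤP.pos-* (↧ₙ p) (↧ₙ q))) (sym (ℤP.pos-* 1 (↧ₙ s))))
                 (cong (+ 4 * ↥ s *_) (sym (trans (ℤP.pos-* (↧ₙ p ℕ.* ↧ₙ q) (↧ₙ r))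
                                                (cong (_* ↧ r) (ℤP.pos-* (↧ₙ p) (↧ₙ q)))))) ⟩
  ((↥ p * ↧ q + ↥ q * ↧ p) * ↧ r + ↥ r * + (↧ₙ p ℕ.* ↧ₙ q)) * + (1 ℕ.* ↧ₙ s)
    - (+ 4 * ↥ s) * + (↧ₙ p ℕ.* ↧ₙ q ℕ.* ↧ₙ r)
    ≡⟨ ℤP.i≡j⇒i-j≡0 (ℚᵘP.drop-*≡* (solution-≃ᵘ p q r s eq)) ⟩
  0ℤ ∎
  where
  open ≡-Reasoning
  expand : ∀ np nq nr ns dp dq dr ds →
    np * (dq * dr * ds) + nq * (dp * dr * ds) + nr * (dp * dq * ds) - + 4 * (ns * (dp * dq * dr)) ≡
    ((np * dq + nq * dp) * dr + nr * (dp * dq)) * (+ 1 * ds) - (+ 4 * ns) * (dp * dq * dr)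
  expand = solve-∀

num den : ℚ* → ℤ
num = ↥_ ∘ val
den = ↧_ ∘ val

num≢0 : ∀ x → num x ≢ 0ℤ
num≢0 (mkℚ _ _ _ , nz) refl = ℕ.NonZero.nonZero nz

den≢0 : ∀ x → den x ≢ 0ℤ
den≢0 (mkℚ _ _ _ , _) ()

level : ℚ* → ℤ
level x = + ν (num x) - + ν (den x)

-- Modulo 5, (unit den)³ is the inverse of unit den, so ρ x is the residue of the unit part of x.
ρ : ℚ* → ℤ
ρ x = unit (num x) * (w * w * w)
  where
  w : ℤ
  w = unit (den x)

5∤ρ : ∀ x → ¬ 5ℤ ∣ ρ x
5∤ρ x = 5∤-* (5∤unit (num≢0 x)) (5∤-* (5∤-* 5∤w 5∤w) 5∤w)
  where
  5∤w : ¬ 5ℤ ∣ unit (den x)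
  5∤w = 5∤unit (den≢0 x)

Separated : {C : Set} → (ℚ* → C) → Set
Separated c = ∀ x y → c x ≡ c y → level x ≡ level y → 5ℤ ∣ ρ x - ρ y

cofactor : (Fin 4 → ℤ) → Fin 4 → ℤ
cofactor d 0F = d 1F * d 2F * d 3F
cofactor d 1F = d 0F * d 2F * d 3F
cofactor d 2F = d 0F * d 1F * d 3F
cofactor d 3F = d 0F * d 1F * d 2F

cofactor-* : ∀ d i → cofactor d i * d i ≡ d 0F * d 1F * d 2F * d 3F
cofactor-* d 0F = reorder (d 0F) (d 1F) (d 2F) (d 3F)
  where
  reorder : ∀ a b c e → b * c * e * a ≡ a * b * c * e
  reorder = solve-∀
cofactor-* d 1F = reorder (d 0F) (d 1F) (d 2F) (d 3F)
  where
  reorder : ∀ a b c e → a * c * e * b ≡ a * b * c * e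
  reorder = solve-∀
cofactor-* d 2F = reorder (d 0F) (d 1F) (d 2F) (d 3F)
  where
  reorder : ∀ a b c e → a * b * e * c ≡ a * b * c * e
  reorder = solve-∀
cofactor-* d 3F = refl

module ClearingDenominators (x : Fin 4 → ℚ*) where

  common : ℤ
  common = den (x 0F) * den (x 1F) * den (x 2F) * den (x 3F)

  cleared : Fin 4 → ℤ
  cleared i = num (x i) * cofactor (den ∘ x) i

  cleared-* : ∀ i → cleared i * den (x i) ≡ num (x i) * common
  cleared-* i = trans (ℤP.*-assoc (num (x i)) _ _) (cong (num (x i) *_) (cofactor-* (den ∘ x) i))

  common≢0 : common ≢ 0ℤ
  common≢0 = *-≢0 (*-≢0 (*-≢0 (den≢0 (x 0F)) (den≢0 (x 1F))) (den≢0 (x 2F))) (den≢0 (x 3F))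

  cleared≢0 : ∀ i → cleared i ≢ 0ℤ
  cleared≢0 i = *-≢0 (num≢0 (x i)) λ cofactor≡0 → common≢0 (begin
    common                          ≡⟨ cofactor-* (den ∘ x) i ⟨
    cofactor (den ∘ x) i * den (x i) ≡⟨ cong (_* den (x i)) cofactor≡0 ⟩
    0ℤ * den (x i)                  ≡⟨ ℤP.*-zeroˡ (den (x i)) ⟩
    0ℤ                              ∎)
    where open ≡-Reasoning

  ν-unit-cleared : ∀ i → ν (cleared i) ℕ.+ ν (den (x i)) ≡ ν (num (x i)) ℕ.+ ν common
                       × unit (cleared i) * unit (den (x i)) ≡ unit (num (x i)) * unit common
  ν-unit-cleared i = ν-unit-cross (cleared≢0 i) (den≢0 (x i)) (num≢0 (x i)) common≢0 (cleared-* i)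

  level-cleared : ∀ i → level (x i) ≡ + ν (cleared i) - + ν common
  level-cleared i =
    a+b≡c+e⇒c-b≡a-e {+ ν (cleared i)} {+ ν (den (x i))} {+ ν (num (x i))} {+ ν common} (begin
    + ν (cleared i) + + ν (den (x i))     ≡⟨ ℤP.pos-+ (ν (cleared i)) (ν (den (x i))) ⟨
    + (ν (cleared i) ℕ.+ ν (den (x i)))   ≡⟨ cong +_ (proj₁ (ν-unit-cleared i)) ⟩
    + (ν (num (x i)) ℕ.+ ν common)        ≡⟨ ℤP.pos-+ (ν (num (x i))) (ν common) ⟩
    + ν (num (x i)) + + ν common          ∎)
    where open ≡-Reasoning

  unit-cleared-congruent : ∀ i j → 5ℤ ∣ ρ (x i) - ρ (x j) → 5ℤ ∣ unit (cleared i) - unit (cleared j)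
  unit-cleared-congruent i j =
    congruent-units (unit (cleared i)) (unit (cleared j)) (unit (num (x i))) (unit (num (x j)))
                    (unit (den (x i))) (unit (den (x j))) (unit common)
                    (proj₂ (ν-unit-cleared i)) (proj₂ (ν-unit-cleared j))
                    (fermat₅ _ (5∤unit (den≢0 (x i)))) (fermat₅ _ (5∤unit (den≢0 (x j))))

separated⇒solutionFree : ∀ {C : Set} (c : ℚ* → C) → Separated c → SolutionFree c
separated⇒solutionFree c separated (x₁ , x₂ , x₃ , x₄ , sol , c₁≡c₄ , c₂≡c₄ , c₃≡c₄) =
  Λ≢0-of-congruent-units cleared cleared≢0 congruent
    (cross-multiplied (val x₁) (val x₂) (val x₃) (val x₄) sol)
  where
  x : Fin 4 → ℚ*
  x 0F = x₁
  x 1F = x₂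
  x 2F = x₃
  x 3F = x₄
  open ClearingDenominators x
  colour : ∀ i → c (x i) ≡ c x₄
  colour 0F = c₁≡c₄
  colour 1F = c₂≡c₄
  colour 2F = c₃≡c₄
  colour 3F = refl
  congruent : ∀ i j → ν (cleared i) ≡ ν (cleared j) → 5ℤ ∣ unit (cleared i) - unit (cleared j)
  congruent i j νᵢ≡νⱼ = unit-cleared-congruent i j (separated (x i) (x j)
    (trans (colour i) (sym (colour j)))
    (trans (level-cleared i) (trans (cong (λ n → + n - + ν common) νᵢ≡νⱼ) (sym (level-cleared j)))))

-- Three colours do not suffice

⟨_⟩ : (n : ℕ) → {{ℕ.NonZero n}} → ℚ*
⟨ n ⟩ {{n≢0}} = mkℚ (+ n) 0 (Coprimality.sym (1-coprimeTo n)) , n≢0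

monochromatic-∘-injective : ∀ {A B : Set} {d : ℚ* → A} (f : A → B) → Injective _≡_ _≡_ f →
                            MonochromaticSolution (f ∘ d) → MonochromaticSolution d
monochromatic-∘-injective f f-inj (x₁ , x₂ , x₃ , x₄ , sol , e₁ , e₂ , e₃) =
  x₁ , x₂ , x₃ , x₄ , sol , f-inj e₁ , f-inj e₂ , f-inj e₃

Covers : {C : Set} → C → C → C → Set
Covers a b c = ∀ j → j ≡ a ⊎ j ≡ b ⊎ j ≡ c

covers-swap : ∀ {C : Set} {a b c : C} → Covers a b c → Covers a c b
covers-swap cover j with cover j
... | inj₁ j≡a        = inj₁ j≡a
... | inj₂ (inj₁ j≡b) = inj₂ (inj₂ j≡b)
... | inj₂ (inj₂ j≡c) = inj₂ (inj₁ j≡c)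

Fin3-covers : ∀ (a : Fin 3) → Σ[ b ∈ Fin 3 ] Σ[ c ∈ Fin 3 ] Covers a b c
Fin3-covers 0F = 1F , 2F , λ { 0F → inj₁ refl ; 1F → inj₂ (inj₁ refl) ; 2F → inj₂ (inj₂ refl) }
Fin3-covers 1F = 0F , 2F , λ { 0F → inj₂ (inj₁ refl) ; 1F → inj₁ refl ; 2F → inj₂ (inj₂ refl) }
Fin3-covers 2F = 0F , 1F , λ { 0F → inj₂ (inj₁ refl) ; 1F → inj₂ (inj₂ refl) ; 2F → inj₁ refl }

module ThreeColours {C : Set} (d : ℚ* → C) {a b c : C} (cover : Covers a b c) where

  split : ∀ {R : Set} n → {{_ : ℕ.NonZero n}} →
          (d ⟨ n ⟩ ≡ a → R) → (d ⟨ n ⟩ ≡ b → R) → (d ⟨ n ⟩ ≡ c → R) → R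
  split n ifa ifb ifc with cover (d ⟨ n ⟩)
  ... | inj₁ dn≡a        = ifa dn≡a
  ... | inj₂ (inj₁ dn≡b) = ifb dn≡b
  ... | inj₂ (inj₂ dn≡c) = ifc dn≡c

  mono : ∀ {j} p q r s →
         {{_ : ℕ.NonZero p}} {{_ : ℕ.NonZero q}} {{_ : ℕ.NonZero r}} {{_ : ℕ.NonZero s}} →
         IsSolution ⟨ p ⟩ ⟨ q ⟩ ⟨ r ⟩ ⟨ s ⟩ →
         d ⟨ p ⟩ ≡ j → d ⟨ q ⟩ ≡ j → d ⟨ r ⟩ ≡ j → d ⟨ s ⟩ ≡ j → MonochromaticSolution d
  mono p q r s sol dp dq dr ds =
    ⟨ p ⟩ , ⟨ q ⟩ , ⟨ r ⟩ , ⟨ s ⟩ , sol , trans dp (sym ds) , trans dq (sym ds) , trans dr (sym ds)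

  refute : d ⟨ 4 ⟩ ≡ a → d ⟨ 6 ⟩ ≡ b → MonochromaticSolution d
  refute h₄ h₆ = split 3
    (λ h₃ → mono 4 4 4 3 refl h₄ h₄ h₄ h₃)
    (λ h₃ → mono 3 3 6 3 refl h₃ h₃ h₆ h₃)
    (λ h₃ → split 2
      (λ h₂ → mono 2 2 4 2 refl h₂ h₂ h₄ h₂)
      (λ h₂ → split 8
        (λ h₈ → mono 4 4 8 4 refl h₄ h₄ h₈ h₄)
        (λ h₈ → mono 8 8 8 6 refl h₈ h₈ h₈ h₆)
        (λ h₈ → split 5
          (λ h₅ → split 12
            (λ h₁₂ → mono 4 4 12 5 refl h₄ h₄ h₁₂ h₅)
            (λ h₁₂ → mono 6 6 12 6 refl h₆ h₆ h₁₂ h₆)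
            (λ h₁₂ → mono 8 12 12 8 refl h₈ h₁₂ h₁₂ h₈))
          (λ h₅ → split 12
            (λ h₁₂ → split 7
              (λ h₇ → mono 4 12 12 7 refl h₄ h₁₂ h₁₂ h₇)
              (λ h₇ → mono 6 7 7 5 refl h₆ h₇ h₇ h₅)
              (λ h₇ → split 9
                (λ h₉ → mono 12 12 12 9 refl h₁₂ h₁₂ h₁₂ h₉)
                (λ h₉ → mono 2 9 9 5 refl h₂ h₉ h₉ h₅)
                (λ h₉ → split 1
                  (λ h₁ → split 11
                    (λ h₁₁ → mono 1 4 11 4 refl h₁ h₄ h₁₁ h₄)
                    (λ h₁₁ → mono 2 11 11 6 refl h₂ h₁₁ h₁₁ h₆)
                    (λ h₁₁ → mono 8 9 11 7 refl h₈ h₉ h₁₁ h₇))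
                  (λ h₁ → mono 1 1 2 1 refl h₁ h₁ h₂ h₁)
                  (λ h₁ → mono 1 3 8 3 refl h₁ h₃ h₈ h₃))))
            (λ h₁₂ → mono 2 6 12 5 refl h₂ h₆ h₁₂ h₅)
            (λ h₁₂ → mono 8 12 12 8 refl h₈ h₁₂ h₁₂ h₈))
          (λ h₅ → split 12
            (λ h₁₂ → split 7
              (λ h₇ → mono 4 12 12 7 refl h₄ h₁₂ h₁₂ h₇)
              (λ h₇ → split 9
                (λ h₉ → mono 12 12 12 9 refl h₁₂ h₁₂ h₁₂ h₉)
                (λ h₉ → mono 6 9 9 6 refl h₆ h₉ h₉ h₆)
                (λ h₉ → mono 3 8 9 5 refl h₃ h₈ h₉ h₅))
              (λ h₇ → mono 5 7 8 5 refl h₅ h₇ h₈ h₅))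
            (λ h₁₂ → mono 6 6 12 6 refl h₆ h₆ h₁₂ h₆)
            (λ h₁₂ → mono 3 5 12 5 refl h₃ h₅ h₁₂ h₅))))
      (λ h₂ → mono 2 3 3 2 refl h₂ h₃ h₃ h₂))

three-colourings-monochromatic : (d : ℚ* → Fin 3) → MonochromaticSolution d
three-colourings-monochromatic d with Fin3-covers (d ⟨ 4 ⟩)
... | b , c , cover with cover (d ⟨ 6 ⟩)
...   | inj₁ d₆≡d₄       = ThreeColours.mono d cover 4 6 6 4 refl refl d₆≡d₄ d₆≡d₄ refl
...   | inj₂ (inj₁ d₆≡b) = ThreeColours.refute d cover refl d₆≡b
...   | inj₂ (inj₂ d₆≡c) = ThreeColours.refute d (covers-swap cover) refl d₆≡c

fewer-than-four-colours-monochromatic : ∀ k → k ℕ.< 4 → (d : ℚ* → Fin k) → ¬ SolutionFree d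
fewer-than-four-colours-monochromatic k k<4 d free =
  free (monochromatic-∘-injective (λ i → inject≤ i k≤3) (inject≤-injective k≤3 k≤3 _ _)
          (three-colourings-monochromatic (λ x → inject≤ (d x) k≤3)))
  where
  k≤3 : k ℕ.≤ 3
  k≤3 = ℕP.≤-pred k<4

-- Continuum many minimal colourings

-- The residue 0 never occurs, ρ being prime to 5, so its digit is arbitrary.
toDigit : ∀ r → r ℕ.< 5 → Fin 4
toDigit zero    _     = 0F
toDigit (suc r) 1+r<5 = fromℕ< (ℕP.≤-pred 1+r<5)

toDigit-injective : ∀ {r s} (r<5 : r ℕ.< 5) (s<5 : s ℕ.< 5) → r ≢ 0 → s ≢ 0 →
                    toDigit r r<5 ≡ toDigit s s<5 → r ≡ s
toDigit-injective {zero}          _ _ r≢0 _   _  = contradiction refl r≢0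
toDigit-injective {suc _} {zero}  _ _ _   s≢0 _  = contradiction refl s≢0
toDigit-injective {suc r} {suc s} _ _ _   _   eq = cong suc (fromℕ<-injective r s _ _ eq)

digit : ℤ → Fin 4
digit i = toDigit (residue₅ i) (residue₅<5 i)

swap01 : Fin 4 → Fin 4
swap01 0F = 1F
swap01 1F = 0F
swap01 2F = 2F
swap01 3F = 3F

swap01-involutive : ∀ j → swap01 (swap01 j) ≡ j
swap01-involutive 0F = refl
swap01-involutive 1F = refl
swap01-involutive 2F = refl
swap01-involutive 3F = refl

twist : Bool → Fin 4 → Fin 4
twist false = id
twist true  = swap01

twist-injective : ∀ b → Injective _≡_ _≡_ (twist b)
twist-injective false eq = eq
twist-injective true {i} {j} eq =
  trans (sym (swap01-involutive i)) (trans (cong swap01 eq) (swap01-involutive j))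

flag : (ℕ → Bool) → ℤ → Bool
flag f (+ suc n) = f n
flag f _         = false

colouring : (ℕ → Bool) → ℚ* → Fin 4
colouring f x = twist (flag f (level x)) (digit (ρ x))

colouring-separated : ∀ f → Separated (colouring f)
colouring-separated f x y same-colour same-level = residue₅-≡⇒5∣- (ρ x) (ρ y)
  (toDigit-injective _ _ (5∤ρ x ∘ residue₅≡0⇒5∣ (ρ x)) (5∤ρ y ∘ residue₅≡0⇒5∣ (ρ y)) same-digit)
  where
  same-digit : digit (ρ x) ≡ digit (ρ y)
  same-digit = twist-injective (flag f (level y))
    (subst (λ l → twist (flag f l) (digit (ρ x)) ≡ colouring f y) same-level same-colour)

minimal-colouring : (ℕ → Bool) → MinimalColoring
minimal-colouring f = record
  { m       = 4
  ; col     = colouring f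
  ; free    = separated⇒solutionFree (colouring f) (colouring-separated f)
  ; minimal = fewer-than-four-colours-monochromatic
  }

ν-unit-5^ : ∀ k → ν (+ (5 ℕ.^ k)) ≡ k × unit (+ (5 ℕ.^ k)) ≡ 1ℤ
ν-unit-5^ k = 5-adic-unique _ k (5∤unit 5^k≢0) (5∤-by-computation 1ℤ)
  (trans (sym (ν-unit-correct (+ (5 ℕ.^ k)))) (trans (pos-^ 5 k) (sym (ℤP.*-identityʳ (5ℤ ^ k)))))
  where
  5^k≢0 : + (5 ℕ.^ k) ≢ 0ℤ
  5^k≢0 = 5^≢0 k ∘ trans (sym (pos-^ 5 k))

⟨5^suc_⟩ : ℕ → ℚ*
⟨5^suc n ⟩ = ⟨ 5 ℕ.^ suc n ⟩ {{ℕP.m^n≢0 5 (suc n)}}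

colouring-5^suc : ∀ f n → colouring f ⟨5^suc n ⟩ ≡ twist (f n) 0F
colouring-5^suc f n = cong₂ (λ l r → twist (flag f l) (digit r)) level≡ ρ≡1
  where
  level≡ : level ⟨5^suc n ⟩ ≡ + suc n
  level≡ = trans (cong (λ a → + a - 0ℤ) (proj₁ (ν-unit-5^ (suc n)))) (ℤP.+-identityʳ (+ suc n))
  ρ≡1 : ρ ⟨5^suc n ⟩ ≡ 1ℤ
  ρ≡1 = cong (_* (1ℤ * 1ℤ * 1ℤ)) (proj₂ (ν-unit-5^ (suc n)))

minimal-colouring-injective : ∀ f g → Isomorphic (minimal-colouring f) (minimal-colouring g) → f ≗ g
minimal-colouring-injective f g (φ , f≡φ∘g) n = compare (f n) (g n)
  (trans (sym (colouring-5^suc f n)) (trans (f≡φ∘g ⟨5^suc n ⟩) (cong φ→ (colouring-5^suc g n))))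
  where
  φ→ : Fin 4 → Fin 4
  φ→ = Bijection.to φ
  φ0≡0 : 0F ≡ φ→ 0F
  φ0≡0 = f≡φ∘g ⟨ 1 ⟩
  compare : ∀ a b → twist a 0F ≡ φ→ (twist b 0F) → a ≡ b
  compare false false _  = refl
  compare true  true  _  = refl
  compare true  false eq with () ← trans eq (sym φ0≡0)
  compare false true  eq with () ← Bijection.injective φ (trans (sym φ0≡0) eq)

-- At most continuum many colourings up to isomorphism

pair : ℕ → ℕ → ℕ
pair zero    b = suc (2 ℕ.* b)
pair (suc a) b = 2 ℕ.* pair a b

pair-injective : ∀ {a b c d} → pair a b ≡ pair c d → a ≡ c × b ≡ d
pair-injective {zero}  {b} {zero}  {d} eq = refl , ℕP.*-cancelˡ-≡ b d 2 (ℕP.suc-injective eq)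
pair-injective {zero}  {b} {suc c} {d} eq = contradiction (sym eq) (ℕP.even≢odd (pair c d) b)
pair-injective {suc a} {b} {zero}  {d} eq = contradiction eq (ℕP.even≢odd (pair a b) d)
pair-injective {suc a} {b} {suc c} {d} eq =
  Product.map₁ (cong suc) (pair-injective (ℕP.*-cancelˡ-≡ (pair a b) (pair c d) 2 eq))

zigzag : ℤ → ℕ
zigzag (+ n)    = 2 ℕ.* n
zigzag -[1+ n ] = suc (2 ℕ.* n)

zigzag-injective : ∀ {i j} → zigzag i ≡ zigzag j → i ≡ j
zigzag-injective {+ m}       {+ n}       eq = cong +_ (ℕP.*-cancelˡ-≡ m n 2 eq)
zigzag-injective {+ m}       { -[1+ n ]} eq = contradiction eq (ℕP.even≢odd m n)
zigzag-injective { -[1+ m ]} {+ n}       eq = contradiction (sym eq) (ℕP.even≢odd n m)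
zigzag-injective { -[1+ m ]} { -[1+ n ]} eq = cong -[1+_] (ℕP.*-cancelˡ-≡ m n 2 (ℕP.suc-injective eq))

NonZero-irrelevant : ∀ {n} (p q : ℕ.NonZero n) → p ≡ q
NonZero-irrelevant {suc _} _ _ = refl

code : ℚ* → ℕ
code (mkℚ n d-1 _ , _) = pair (zigzag n) d-1

code-injective : ∀ {x y} → code x ≡ code y → x ≡ y
code-injective {mkℚ n d-1 c , p} {mkℚ n′ _ _ , q} eq
  with pair-injective {zigzag n} {d-1} {zigzag n′} eq
... | n≡n′ , refl with zigzag-injective {n} {n′} n≡n′
... | refl = cong (mkℚ n d-1 c ,_) (NonZero-irrelevant p q)

code² : ℚ* → ℚ* → ℕ
code² x y = pair (code x) (code y)

code²-injective : ∀ {x y x′ y′} → code² x y ≡ code² x′ y′ → x ≡ x′ × y ≡ y′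
code²-injective eq = Product.map code-injective code-injective (pair-injective eq)

-- Otherwise squeezing the colours into one fewer would keep the colouring solution-free.
colour-not-missed : ∀ (c : MinimalColoring) j → ¬ (∀ x → col c x ≢ j)
colour-not-missed c = not-missed (col c) (free c) (minimal c)
  where
  not-missed : ∀ {n} (col : ℚ* → Fin n) → SolutionFree col →
               (∀ k → k ℕ.< n → (d : ℚ* → Fin k) → ¬ SolutionFree d) → ∀ j → ¬ (∀ x → col x ≢ j)
  not-missed {suc n} col free minimal j missed = minimal n ℕP.≤-refl squeezed squeezed-free
    where
    squeezed : ℚ* → Fin n
    squeezed x = punchOut (missed x ∘ sym)
    squeezed-injective : ∀ {x y} → squeezed x ≡ squeezed y → col x ≡ col y
    squeezed-injective {x} {y} = punchOut-injective (missed x ∘ sym) (missed y ∘ sym)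
    squeezed-free : SolutionFree squeezed
    squeezed-free (x₁ , x₂ , x₃ , x₄ , sol , e₁ , e₂ , e₃) =
      free (x₁ , x₂ , x₃ , x₄ , sol ,
            squeezed-injective e₁ , squeezed-injective e₂ , squeezed-injective e₃)

SameKernel : MinimalColoring → MinimalColoring → Set
SameKernel c d = ∀ x y → col c x ≡ col c y ⇔ col d x ≡ col d y

isomorphic⇒same-kernel : ∀ c d → Isomorphic c d → SameKernel c d
isomorphic⇒same-kernel c d (φ , c≡φ∘d) x y = mk⇔
  (λ cx≡cy → Bijection.injective φ (trans (sym (c≡φ∘d x)) (trans cx≡cy (c≡φ∘d y))))
  (λ dx≡dy → trans (c≡φ∘d x) (trans (cong (Bijection.to φ) dx≡dy) (sym (c≡φ∘d y))))

same-kernel⇒isomorphic : ∀ c d → (∀ j → ∃ λ x → col d x ≡ j) → (∀ i → ∃ λ x → col c x ≡ i) →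
                         SameKernel c d → Isomorphic c d
same-kernel⇒isomorphic c d d-onto c-onto kernel =
  mk⤖ (ψ-injective , strictlySurjective⇒surjective ψ-onto) , c≡ψ∘d
  where
  point : Fin (m d) → ℚ*
  point j = proj₁ (d-onto j)
  ψ : Fin (m d) → Fin (m c)
  ψ j = col c (point j)
  c≡ψ∘d : ∀ x → col c x ≡ ψ (col d x)
  c≡ψ∘d x = Equivalence.from (kernel x (point (col d x))) (sym (proj₂ (d-onto (col d x))))
  ψ-injective : ∀ {j j′} → ψ j ≡ ψ j′ → j ≡ j′
  ψ-injective {j} {j′} ψj≡ψj′ = begin
    j                      ≡⟨ proj₂ (d-onto j) ⟨
    col d (point j)        ≡⟨ Equivalence.to (kernel (point j) (point j′)) ψj≡ψj′ ⟩
    col d (point j′)       ≡⟨ proj₂ (d-onto j′) ⟩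
    j′                     ∎
    where open ≡-Reasoning
  ψ-onto : ∀ i → ∃ λ j → ψ j ≡ i
  ψ-onto i = col d (proj₁ (c-onto i)) , trans (sym (c≡ψ∘d (proj₁ (c-onto i)))) (proj₂ (c-onto i))

module Classical (lem : ExcludedMiddle 0ℓ) where

  SameColourCode : MinimalColoring → ℕ → Set
  SameColourCode c n = Σ ℚ* λ x → Σ ℚ* λ y → code² x y ≡ n × col c x ≡ col c y

  does≡true⇒ : ∀ {P : Set} → does (lem {P}) ≡ true → P
  does≡true⇒ does≡true =
    decidable-stable lem λ ¬p → contradiction (trans (sym does≡true) (dec-false lem ¬p)) λ ()

  profile : MinimalColoring → ℕ → Bool
  profile c n = does (lem {SameColourCode c n})

  every-colour-used : ∀ c j → ∃ λ x → col c x ≡ j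
  every-colour-used c j =
    decidable-stable lem λ unused → colour-not-missed c j (λ x cx≡j → unused (x , cx≡j))

  same-kernel⇒same-profile : ∀ c d → SameKernel c d → profile c ≗ profile d
  same-kernel⇒same-profile c d kernel n = does-⇔ (mk⇔ to from) lem lem
    where
    to : SameColourCode c n → SameColourCode d n
    to (x , y , code≡n , cx≡cy) = x , y , code≡n , Equivalence.to (kernel x y) cx≡cy
    from : SameColourCode d n → SameColourCode c n
    from (x , y , code≡n , dx≡dy) = x , y , code≡n , Equivalence.from (kernel x y) dx≡dy

  same-profile⇒kernel-⊆ : ∀ c d → profile c ≗ profile d →
                          ∀ x y → col c x ≡ col c y → col d x ≡ col d y
  same-profile⇒kernel-⊆ c d same x y cx≡cy = decode witness
    where
    witness : SameColourCode d (code² x y)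
    witness = does≡true⇒ (trans (sym (same (code² x y))) (dec-true lem (x , y , refl , cx≡cy)))
    decode : SameColourCode d (code² x y) → col d x ≡ col d y
    decode (x′ , y′ , code≡ , dx′≡dy′) with code²-injective {x′} {y′} {x} {y} code≡
    ... | refl , refl = dx′≡dy′

  same-profile⇒same-kernel : ∀ c d → profile c ≗ profile d → SameKernel c d
  same-profile⇒same-kernel c d same x y =
    mk⇔ (same-profile⇒kernel-⊆ c d same x y) (same-profile⇒kernel-⊆ d c (sym ∘ same) x y)

proposition9 : AtLeastContinuum × (ExcludedMiddle 0ℓ → AtMostContinuum)
proposition9 = (minimal-colouring , minimal-colouring-injective) , λ lem →
  let open Classical lem in
  profile ,
  (λ c d c≅d → same-kernel⇒same-profile c d (isomorphic⇒same-kernel c d c≅d)) ,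
  (λ c d same → same-kernel⇒isomorphic c d (every-colour-used d) (every-colour-used c)
                                       (same-profile⇒same-kernel c d same))
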